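{- Let $G$ be an induced-subgraph-minimal non-sesquicograph. Then $G$ is $2$-connected and its complement $\overline{G}$ is connected.
   Context: For vertex-disjoint graphs $G$ and $H$: the $0$-sum is their disjoint union; a $1$-sum is obtained from the disjoint union by identifying one vertex of $G$ with one vertex of $H$; the join is obtained from the disjoint union by adding all edges between $V(G)$ and $V(H)$. A sesquicograph is a finite simple graph that can be generated from the one-vertex graph $K_1$ using joins, $0$-sums and $1$-sums. An induced-subgraph-minimal non-sesquicograph is a graph that is not a sesquicograph but every proper induced subgraph of which is a sesquicograph. A graph is $2$-connected if it is connected, has at least three vertices, and has no cut vertex. -}

module Defs where

open import Data.Nat using (ℕ; zero; suc; _+_; _≤_; _<_)
open import Data.Fin using (Fin; splitAt; punchIn; _≟_)
open import Data.Bool using (Bool; true; false; not; if_then_else_)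
open import Data.Sum using (_⊎_; inj₁; inj₂)
open import Data.Product using (Σ; _×_; _,_)
open import Relation.Nullary.Decidable using (⌊_⌋)
open import Relation.Binary.PropositionalEquality using (_≡_)
open import Function.Bundles using (_⤖_; Bijection)
open import Function.Definitions using (Injective)
open import Data.Unit using (⊤)

-- A (loopless, undirected) graph on vertex set Fin n, given by a
-- Boolean adjacency function.  Simplicity is a separate predicate.
Graph : ℕ → Set
Graph n = Fin n → Fin n → Bool

IsSimple : ∀ {n} → Graph n → Set
IsSimple {n} G = (∀ (x y : Fin n) → G x y ≡ G y x) × (∀ (x : Fin n) → G x x ≡ false)

_≅_ : ∀ {n m} → Graph n → Graph m → Set
_≅_ {n} {m} G H = Σ (Fin n ⤖ Fin m) λ f →
  ∀ x y → G x y ≡ H (Bijection.to f x) (Bijection.to f y)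

K1 : Graph 1
K1 _ _ = false

sum0 : ∀ {n m} → Graph n → Graph m → Graph (n + m)
sum0 {n} G H x y with splitAt n x | splitAt n y
... | inj₁ a | inj₁ b = G a b
... | inj₂ a | inj₂ b = H a b
... | inj₁ _ | inj₂ _ = false
... | inj₂ _ | inj₁ _ = false

join : ∀ {n m} → Graph n → Graph m → Graph (n + m)
join {n} G H x y with splitAt n x | splitAt n y
... | inj₁ a | inj₁ b = G a b
... | inj₂ a | inj₂ b = H a b
... | inj₁ _ | inj₂ _ = true
... | inj₂ _ | inj₁ _ = true

-- 1-sum: identify vertex u of G with vertex v of H.  The result has
-- vertex set Fin (n + m): the first n vertices are those of G (u being
-- the identified vertex), the last m are the vertices of H other than v
-- (vertex b of the second part is vertex punchIn v b of H).
sum1 : ∀ {n m} → Graph n → Fin n → Graph (suc m) → Fin (suc m) → Graph (n + m)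
sum1 {n} G u H v x y with splitAt n x | splitAt n y
... | inj₁ a | inj₁ b = G a b
... | inj₂ a | inj₂ b = H (punchIn v a) (punchIn v b)
... | inj₁ a | inj₂ b = if ⌊ a ≟ u ⌋ then H v (punchIn v b) else false
... | inj₂ a | inj₁ b = if ⌊ b ≟ u ⌋ then H (punchIn v a) v else false

data Sesqui : ∀ {n} → Graph n → Set where
  s-K1   : Sesqui K1
  s-sum0 : ∀ {n m} {G : Graph n} {H : Graph m} → Sesqui G → Sesqui H → Sesqui (sum0 G H)
  s-join : ∀ {n m} {G : Graph n} {H : Graph m} → Sesqui G → Sesqui H → Sesqui (join G H)
  s-sum1 : ∀ {n m} {G : Graph n} {H : Graph (suc m)} (u : Fin n) (v : Fin (suc m)) →
           Sesqui G → Sesqui H → Sesqui (sum1 G u H v)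
  s-iso  : ∀ {n m} {G : Graph n} {H : Graph m} → Sesqui G → G ≅ H → Sesqui H

induced : ∀ {n k} → Graph n → (Fin k → Fin n) → Graph k
induced G S i j = G (S i) (S j)

MinimalNonSesqui : ∀ {n} → Graph n → Set
MinimalNonSesqui {n} G =
  (Sesqui G → Data.Empty.⊥) ×
  (∀ {k} (S : Fin k → Fin n) → Injective _≡_ _≡_ S → 1 ≤ k → k < n → Sesqui (induced G S))
  where import Data.Empty

data Walk {n} (G : Graph n) : Fin n → Fin n → Set where
  here : ∀ {x} → Walk G x x
  step : ∀ {x y z} → G x y ≡ true → Walk G y z → Walk G x z

Connected : ∀ {n} → Graph n → Set
Connected {n} G = (1 ≤ n) × (∀ x y → Walk G x y)

delete : ∀ {m} → Graph (suc m) → Fin (suc m) → Graph m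
delete G v = induced G (punchIn v)

NoCutVertex : ∀ {n} → Graph n → Set
NoCutVertex {zero} G = ⊤
NoCutVertex {suc m} G = ∀ v → Connected (delete G v)

TwoConnected : ∀ {n} → Graph n → Set
TwoConnected {n} G = Connected G × (3 ≤ n) × NoCutVertex G

complement : ∀ {n} → Graph n → Graph n
complement G x y = if ⌊ x ≟ y ⌋ then false else not (G x y)

-- Every way of failing the conclusion exhibits G as a 0-sum, a join or a
-- 1-sum of two proper induced subgraphs, which are sesquicographs by
-- minimality.  If G is disconnected, a component C splits off as a 0-sum;
-- if the complement is disconnected, C splits off as a join; and if G - v
-- is disconnected with a component C, then G is the 1-sum, at v, of
-- G[C + v] and G[V - C].  Finally K₁ is a sesquicograph, and no graph on two
-- vertices is connected together with its complement, so G has at least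
-- three vertices.

module Submission where

open import Defs
open import Data.Nat using (ℕ; zero; suc; _+_; _≤_; _<_; z≤n; s≤s)
open import Data.Nat.Properties using (m<m+n; m<n+m; m<n⇒0<n)
open import Data.Fin using (Fin; zero; suc; splitAt; punchIn; punchOut; _≟_)
open import Data.Fin.Properties
  using (+↔⊎; toℕ<n; punchInᵢ≢i; punchIn-punchOut; punchOut-punchIn; punchOut-cong; any?)
open import Data.Fin.Permutation using (↔⇒≡)
open import Data.Fin.Subset using (Subset; inside; outside; _∈_; _∉_; _⊃_; _∪_; ⁅_⁆)
open import Data.Fin.Subset.Properties using (_∈?_; x∈⁅x⁆; x∈⁅y⁆⇒x≡y; q⊆p∪q; x∈p∪q⁺; x∈p∪q⁻)
open import Data.Fin.Subset.Induction using (⊃-wellFounded; Acc; acc)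
open import Data.Vec using ([]; _∷_; here; there)
open import Data.Bool using (true; false; not)
import Data.Bool.Properties as Bool
open import Data.Sum using (_⊎_; inj₁; inj₂)
open import Data.Sum.Properties using (inj₁-injective; inj₂-injective)
open import Data.Sum.Algebra using (⊎-cong; ⊎-comm; ⊎-assoc)
open import Data.Product using (∃; _×_; _,_; proj₁; proj₂)
open import Level using (0ℓ)
open import Relation.Nullary using (¬_; yes; no; contradiction)
open import Relation.Nullary.Decidable using (_×-dec_; ¬?; decidable-stable)
open import Relation.Binary.PropositionalEquality
open import Function.Base using (_∘_)
open import Function.Bundles using (_↔_; _⤖_; Inverse; Injection; mk↔ₛ′)
open import Function.Definitions using (Injective)
open import Function.Properties.Inverse using (↔-refl; ↔-sym; ↔⇒⤖; ↔⇒↣)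
open import Function.Construct.Composition using (_↔-∘_)
open import Function.Construct.Identity using (⤖-id)

private
  variable
    k m n : ℕ

walk-snoc : {G : Graph n} {x u w : Fin n} → Walk G x u → G u w ≡ true → Walk G x w
walk-snoc here e = step e here
walk-snoc (step e′ walk) e = step e′ (walk-snoc walk e)

Closed : Graph n → Subset n → Set
Closed G C = ∀ {u w} → u ∈ C → G u w ≡ true → w ∈ C

closed-no-exit : {G : Graph n} {C : Subset n} {u w : Fin n} →
                 Closed G C → u ∈ C → w ∉ C → G u w ≡ false
closed-no-exit {G = G} {u = u} {w} closed u∈C w∉C with G u w in e
... | true  = contradiction (closed u∈C e) w∉C
... | false = refl

-- Grow the set of vertices known to be reachable from x, one exit edge at a
-- time, until it either contains y or has no exit edge.
walk-or-separator : (G : Graph n) (x y : Fin n) →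
                    Walk G x y ⊎ ∃ λ C → Closed G C × x ∈ C × y ∉ C
walk-or-separator {n} G x y = grow ⁅ x ⁆ (⊃-wellFounded _) (x∈⁅x⁆ x) reach-x
  where
  Result : Set
  Result = Walk G x y ⊎ ∃ λ C → Closed G C × x ∈ C × y ∉ C

  reach-x : ∀ {z} → z ∈ ⁅ x ⁆ → Walk G x z
  reach-x z∈⁅x⁆ rewrite x∈⁅y⁆⇒x≡y x z∈⁅x⁆ = here

  grow : (C : Subset n) → Acc _⊃_ C → x ∈ C → (∀ {z} → z ∈ C → Walk G x z) → Result
  grow C (acc smaller) x∈C reach with y ∈? C
  ... | yes y∈C = inj₁ (reach y∈C)
  ... | no y∉C with any? (λ u → any? λ w → u ∈? C ×-dec G u w Bool.≟ true ×-dec ¬? (w ∈? C))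
  ...   | no no-exit = inj₂ (C , closed , x∈C , y∉C)
    where
    closed : Closed G C
    closed {u} {w} u∈C e = decidable-stable (w ∈? C) λ w∉C → no-exit (u , w , u∈C , e , w∉C)
  ...   | yes (u , w , u∈C , e , w∉C) =
    grow (⁅ w ⁆ ∪ C) (smaller C⊂C′) (q⊆p∪q ⁅ w ⁆ C x∈C) reach′
    where
    C⊂C′ : (⁅ w ⁆ ∪ C) ⊃ C
    C⊂C′ = q⊆p∪q ⁅ w ⁆ C , w , x∈p∪q⁺ (inj₁ (x∈⁅x⁆ w)) , w∉C
    reach′ : ∀ {z} → z ∈ ⁅ w ⁆ ∪ C → Walk G x z
    reach′ z∈C′ with x∈p∪q⁻ ⁅ w ⁆ C z∈C′
    ... | inj₁ z∈⁅w⁆ rewrite x∈⁅y⁆⇒x≡y w z∈⁅w⁆ = walk-snoc (reach u∈C) e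
    ... | inj₂ z∈C = reach z∈C

pivot : Fin (suc n) → (Fin 1 ⊎ Fin n) ↔ Fin (suc n)
pivot {n} v = mk↔ₛ′ to from to-from from-to
  where
  to : Fin 1 ⊎ Fin n → Fin (suc n)
  to (inj₁ _) = v
  to (inj₂ i) = punchIn v i
  from : Fin (suc n) → Fin 1 ⊎ Fin n
  from x with v ≟ x
  ... | yes _ = inj₁ zero
  ... | no v≢x = inj₂ (punchOut v≢x)
  to-from : ∀ x → to (from x) ≡ x
  to-from x with v ≟ x
  ... | yes v≡x = v≡x
  ... | no v≢x = punchIn-punchOut v≢x
  from-to : ∀ s → from (to s) ≡ s
  from-to (inj₁ zero) with v ≟ v
  ... | yes _ = refl
  ... | no v≢v = contradiction refl v≢v
  from-to (inj₂ i) with v ≟ punchIn v i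
  ... | yes v≡v′ = contradiction (sym v≡v′) (punchInᵢ≢i v i)
  ... | no _ = cong inj₂ (trans (punchOut-cong v refl) (punchOut-punchIn v))

-- The new left element goes to v, the old vertices are shifted by punchIn v.
extendˡ : Fin (suc n) → (Fin k ⊎ Fin m) ↔ Fin n → (Fin (suc k) ⊎ Fin m) ↔ Fin (suc n)
extendˡ {n} {k} {m} v J =
  pivot v ↔-∘ (⊎-cong ↔-refl J ↔-∘ (⊎-assoc 0ℓ (Fin 1) (Fin k) (Fin m) ↔-∘ ⊎-cong (+↔⊎ {1}) ↔-refl))

extendʳ : Fin (suc n) → (Fin k ⊎ Fin m) ↔ Fin n → (Fin k ⊎ Fin (suc m)) ↔ Fin (suc n)
extendʳ {k = k} {m} v J = extendˡ v (J ↔-∘ ⊎-comm (Fin m) (Fin k)) ↔-∘ ⊎-comm (Fin k) (Fin (suc m))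

module Splitting (J : (Fin k ⊎ Fin m) ↔ Fin n) where

  ι₁ : Fin k → Fin n
  ι₁ = Inverse.to J ∘ inj₁

  ι₂ : Fin m → Fin n
  ι₂ = Inverse.to J ∘ inj₂

  private
    J-injective : Injective _≡_ _≡_ (Inverse.to J)
    J-injective = Injection.injective (↔⇒↣ J)

  ι₁-injective : Injective _≡_ _≡_ ι₁
  ι₁-injective = inj₁-injective ∘ J-injective

  ι₂-injective : Injective _≡_ _≡_ ι₂
  ι₂-injective = inj₂-injective ∘ J-injective

  ι₁≢ι₂ : ∀ a b → ι₁ a ≢ ι₂ b
  ι₁≢ι₂ a b eq with J-injective eq
  ... | ()

  splitting : Fin (k + m) ⤖ Fin n
  splitting = ↔⇒⤖ (J ↔-∘ +↔⊎)

  k+m≡n : k + m ≡ n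
  k+m≡n = ↔⇒≡ (J ↔-∘ +↔⊎)

  left-proper : Fin m → k < n
  left-proper b rewrite sym k+m≡n = m<m+n k (m<n⇒0<n (toℕ<n b))

  right-proper : Fin k → m < n
  right-proper a rewrite sym k+m≡n = m<n+m m (m<n⇒0<n (toℕ<n a))

  module _ {G : Graph n} (symmetric : ∀ x y → G x y ≡ G y x) where

    sum0-≅ : (∀ a b → G (ι₁ a) (ι₂ b) ≡ false) → sum0 (induced G ι₁) (induced G ι₂) ≅ G
    sum0-≅ no-cross = splitting , agree
      where
      agree : ∀ z w → sum0 (induced G ι₁) (induced G ι₂) z w
                    ≡ G (Inverse.to J (splitAt k z)) (Inverse.to J (splitAt k w))
      agree z w with splitAt k z | splitAt k w
      ... | inj₁ a | inj₁ b = refl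
      ... | inj₂ a | inj₂ b = refl
      ... | inj₁ a | inj₂ b = sym (no-cross a b)
      ... | inj₂ a | inj₁ b = sym (trans (symmetric _ _) (no-cross b a))

    join-≅ : (∀ a b → G (ι₁ a) (ι₂ b) ≡ true) → join (induced G ι₁) (induced G ι₂) ≅ G
    join-≅ all-cross = splitting , agree
      where
      agree : ∀ z w → join (induced G ι₁) (induced G ι₂) z w
                    ≡ G (Inverse.to J (splitAt k z)) (Inverse.to J (splitAt k w))
      agree z w with splitAt k z | splitAt k w
      ... | inj₁ a | inj₁ b = refl
      ... | inj₂ a | inj₂ b = refl
      ... | inj₁ a | inj₂ b = sym (all-cross a b)
      ... | inj₂ a | inj₁ b = sym (trans (symmetric _ _) (all-cross b a))

-- ι₁ zero is the cut vertex, shared by both sides of the 1-sum.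
module CutSplitting (J : (Fin (suc k) ⊎ Fin m) ↔ Fin n) where

  open Splitting J public

  ι₂⁺ : Fin (suc m) → Fin n
  ι₂⁺ zero = ι₁ zero
  ι₂⁺ (suc b) = ι₂ b

  ι₂⁺-injective : Injective _≡_ _≡_ ι₂⁺
  ι₂⁺-injective {zero} {zero} _ = refl
  ι₂⁺-injective {zero} {suc b} eq = contradiction eq (ι₁≢ι₂ zero b)
  ι₂⁺-injective {suc a} {zero} eq = contradiction (sym eq) (ι₁≢ι₂ zero a)
  ι₂⁺-injective {suc a} {suc b} eq = cong suc (ι₂-injective eq)

  right⁺-proper : Fin k → suc m < n
  right⁺-proper a rewrite sym k+m≡n = s≤s (m<n+m m (m<n⇒0<n (toℕ<n a)))

  sum1-≅ : {G : Graph n} → (∀ x y → G x y ≡ G y x) →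
           (∀ a b → G (ι₁ (suc a)) (ι₂ b) ≡ false) →
           sum1 (induced G ι₁) zero (induced G ι₂⁺) zero ≅ G
  sum1-≅ {G} symmetric no-cross = splitting , agree
    where
    agree : ∀ z w → sum1 (induced G ι₁) zero (induced G ι₂⁺) zero z w
                  ≡ G (Inverse.to J (splitAt (suc k) z)) (Inverse.to J (splitAt (suc k) w))
    agree z w with splitAt (suc k) z | splitAt (suc k) w
    ... | inj₁ a | inj₁ b = refl
    ... | inj₂ a | inj₂ b = refl
    ... | inj₁ zero | inj₂ b = refl
    ... | inj₁ (suc a) | inj₂ b = sym (no-cross a b)
    ... | inj₂ a | inj₁ zero = refl
    ... | inj₂ a | inj₁ (suc b) = sym (trans (symmetric _ _) (no-cross b a))

record Bipartition (C : Subset n) : Set where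
  field
    {size₁ size₂} : ℕ
    index : (Fin size₁ ⊎ Fin size₂) ↔ Fin n
    index-inj₁ : ∀ a → Inverse.to index (inj₁ a) ∈ C
    index-inj₂ : ∀ b → Inverse.to index (inj₂ b) ∉ C

  member : ∀ {x} → x ∈ C → Fin size₁
  member {x} x∈C with Inverse.from index x in eq
  ... | inj₁ a = a
  ... | inj₂ b = contradiction (subst (_∈ C) to-from x∈C) (index-inj₂ b)
    where
    to-from : x ≡ Inverse.to index (inj₂ b)
    to-from = trans (sym (Inverse.strictlyInverseˡ index x)) (cong (Inverse.to index) eq)

  nonmember : ∀ {y} → y ∉ C → Fin size₂
  nonmember {y} y∉C with Inverse.from index y in eq
  ... | inj₂ b = b
  ... | inj₁ a = contradiction (subst (_∈ C) from-to (index-inj₁ a)) y∉C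
    where
    from-to : Inverse.to index (inj₁ a) ≡ y
    from-to = trans (cong (Inverse.to index) (sym eq)) (Inverse.strictlyInverseˡ index y)

bipartition : (C : Subset n) → Bipartition C
bipartition [] = record { index = ↔-sym (+↔⊎ {0}) ; index-inj₁ = λ () ; index-inj₂ = λ () }
bipartition (inside ∷ C) = record
  { index = extendˡ zero index
  ; index-inj₁ = λ { zero → here ; (suc a) → there (index-inj₁ a) }
  ; index-inj₂ = λ { b (there b∈C) → index-inj₂ b b∈C }
  }
  where open Bipartition (bipartition C)
bipartition (outside ∷ C) = record
  { index = extendʳ zero index
  ; index-inj₁ = λ a → there (index-inj₁ a)
  ; index-inj₂ = λ { zero () ; (suc b) (there b∈C) → index-inj₂ b b∈C }
  }
  where open Bipartition (bipartition C)

complement-false : {G : Graph n} {u w : Fin n} → u ≢ w → complement G u w ≡ false → G u w ≡ true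
complement-false {u = u} {w} u≢w with u ≟ w
... | yes u≡w = contradiction u≡w u≢w
... | no _ = Bool.not-injective

module Minimal {G : Graph n} (simple : IsSimple G) (minimal : MinimalNonSesqui G) where

  private
    symmetric : ∀ x y → G x y ≡ G y x
    symmetric = proj₁ simple

    not-sesqui : ¬ Sesqui G
    not-sesqui = proj₁ minimal

  sesqui-induced : {S : Fin k → Fin n} → Injective _≡_ _≡_ S → Fin k → k < n → Sesqui (induced G S)
  sesqui-induced S-injective a k<n = proj₂ minimal _ S-injective (m<n⇒0<n (toℕ<n a)) k<n

  module Sides {C : Subset n} {x y : Fin n} (x∈C : x ∈ C) (y∉C : y ∉ C) where

    open Bipartition (bipartition C) public
    open Splitting index public

    sesqui₁ : Sesqui (induced G ι₁)
    sesqui₁ = sesqui-induced ι₁-injective (member x∈C) (left-proper (nonmember y∉C))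

    sesqui₂ : Sesqui (induced G ι₂)
    sesqui₂ = sesqui-induced ι₂-injective (nonmember y∉C) (right-proper (member x∈C))

  walks : ∀ x y → Walk G x y
  walks x y with walk-or-separator G x y
  ... | inj₁ walk = walk
  ... | inj₂ (C , closed , x∈C , y∉C) =
    contradiction (s-iso (s-sum0 sesqui₁ sesqui₂) (sum0-≅ symmetric no-cross)) not-sesqui
    where
    open Sides x∈C y∉C
    no-cross : ∀ a b → G (ι₁ a) (ι₂ b) ≡ false
    no-cross a b = closed-no-exit closed (index-inj₁ a) (index-inj₂ b)

  co-walks : ∀ x y → Walk (complement G) x y
  co-walks x y with walk-or-separator (complement G) x y
  ... | inj₁ walk = walk
  ... | inj₂ (C , closed , x∈C , y∉C) =
    contradiction (s-iso (s-join sesqui₁ sesqui₂) (join-≅ symmetric all-cross)) not-sesqui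
    where
    open Sides x∈C y∉C
    all-cross : ∀ a b → G (ι₁ a) (ι₂ b) ≡ true
    all-cross a b =
      complement-false {G = G} (ι₁≢ι₂ a b) (closed-no-exit closed (index-inj₁ a) (index-inj₂ b))

walks-avoiding : {G : Graph (suc n)} → IsSimple G → MinimalNonSesqui G →
                 ∀ v x y → Walk (delete G v) x y
walks-avoiding {G = G} simple minimal v x y with walk-or-separator (delete G v) x y
... | inj₁ walk = walk
... | inj₂ (C , closed , x∈C , y∉C) =
  contradiction (s-iso (s-sum1 zero zero sesqui₁ sesqui₂) (sum1-≅ (proj₁ simple) no-cross))
                (proj₁ minimal)
  where
  open Minimal simple minimal using (sesqui-induced)
  open Bipartition (bipartition C)
  open CutSplitting (extendˡ v index)
  sesqui₁ : Sesqui (induced G ι₁)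
  sesqui₁ = sesqui-induced ι₁-injective zero (left-proper (nonmember y∉C))
  sesqui₂ : Sesqui (induced G ι₂⁺)
  sesqui₂ = sesqui-induced ι₂⁺-injective zero (right⁺-proper (member x∈C))
  no-cross : ∀ a b → G (ι₁ (suc a)) (ι₂ b) ≡ false
  no-cross a b = closed-no-exit closed (index-inj₁ a) (index-inj₂ b)

no-cut-vertex : {G : Graph n} → 3 ≤ n → IsSimple G → MinimalNonSesqui G → NoCutVertex G
no-cut-vertex (s≤s (s≤s _)) simple minimal v = s≤s z≤n , walks-avoiding simple minimal v

edge-of-walk : {G : Graph 2} → (∀ x → G x x ≡ false) → Walk G zero (suc zero) → G zero (suc zero) ≡ true
edge-of-walk irreflexive (step {y = zero} e _) = contradiction (trans (sym e) (irreflexive zero)) λ ()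
edge-of-walk irreflexive (step {y = suc zero} e _) = e

at-least-three : {G : Graph n} → IsSimple G → 1 ≤ n → ¬ Sesqui G →
                 (∀ x y → Walk G x y) → (∀ x y → Walk (complement G) x y) → 3 ≤ n
at-least-three {1} (_ , irreflexive) _ not-sesqui _ _ =
  contradiction (s-iso s-K1 (⤖-id _ , λ { zero zero → sym (irreflexive zero) })) not-sesqui
at-least-three {2} {G} (_ , irreflexive) _ _ walks co-walks =
  contradiction (trans (sym co-edge) (cong not edge)) λ ()
  where
  edge : G zero (suc zero) ≡ true
  edge = edge-of-walk irreflexive (walks zero (suc zero))
  co-edge : not (G zero (suc zero)) ≡ true
  co-edge = edge-of-walk (λ { zero → refl ; (suc zero) → refl }) (co-walks zero (suc zero))
at-least-three {suc (suc (suc _))} _ _ _ _ _ = s≤s (s≤s (s≤s z≤n))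

lemma3p3 : ∀ {n} (G : Graph n) → IsSimple G → 1 ≤ n → MinimalNonSesqui G →
    TwoConnected G × Connected (complement G)
lemma3p3 {n} G simple 1≤n minimal =
  ((1≤n , walks) , three , no-cut-vertex three simple minimal) , (1≤n , co-walks)
  where
  open Minimal simple minimal
  three : 3 ≤ n
  three = at-least-three simple 1≤n (proj₁ minimal) walks co-walks
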